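{- Work in ZF (without the Axiom of Choice). There exists a countable family $\mathcal{F}$ of continuous self-maps of the Cantor set $2^\omega$ such that for every countable set $S\subseteq 2^\omega$ whose square $S\times S$ is covered by $\mathcal{F}$, there exists $y\in 2^\omega\setminus S$ such that $(S\cup\{y\})\times(S\cup\{y\})$ is also covered by $\mathcal{F}$. More precisely, for every $x\in S$ there is $f\in\mathcal{F}$ such that $x=f(y)$.
   Context: $2^\omega$ denotes the Cantor set with the product topology. Here "$S$ is countable" means that there exists a bijection $x\colon\omega\to S$. A set $M\subseteq 2^\omega\times 2^\omega$ is covered by a family of functions $\mathcal{F}$ if for every $(a,b)\in M$ there is $f\in\mathcal{F}$ such that either $b=f(a)$ or $a=f(b)$. -}

module Defs where

open import Data.Nat using (ℕ; _<_)
open import Data.Bool using (Bool)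
open import Data.Product using (Σ; ∃; _×_)
open import Data.Sum using (_⊎_)
open import Relation.Binary.PropositionalEquality using (_≡_)

Cantor : Set
Cantor = ℕ → Bool

_≈_ : Cantor → Cantor → Set
x ≈ z = ∀ k → x k ≡ z k

Agree : ℕ → Cantor → Cantor → Set
Agree n x z = ∀ k → k < n → x k ≡ z k

-- Continuity w.r.t. the product topology on 2^ω.
Continuous : (Cantor → Cantor) → Set
Continuous f = ∀ x n → ∃ λ m → ∀ z → Agree m x z → Agree n (f x) (f z)

-- Countable (= bijection with ω) family of maps, given by an injective
-- enumeration (maps identified extensionally).
InjectiveFamily : (ℕ → Cantor → Cantor) → Set
InjectiveFamily F = ∀ i j → (∀ x → F i x ≈ F j x) → i ≡ j

-- Countable subset S of 2^ω, given by an injective enumeration s : ω → 2^ω;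
-- S is its image.
InjectiveSeq : (ℕ → Cantor) → Set
InjectiveSeq s = ∀ i j → s i ≈ s j → i ≡ j

InS : (ℕ → Cantor) → Cantor → Set
InS s x = ∃ λ n → s n ≈ x

CoveredSq : (ℕ → Cantor → Cantor) → (Cantor → Set) → Set
CoveredSq F P = ∀ a b → P a → P b → ∃ λ i → (b ≈ F i a) ⊎ (a ≈ F i b)

module Submission where

-- Fix a pairing ⟨_,_⟩ : ℕ × ℕ → ℕ with a computable inverse and
-- view a point y of 2^ω as an ω × ω table whose cell (r , k) is
-- y ⟨ r , k ⟩.  The family consists of coordinate reindexings:
-- F 0 is the identity and F (suc n) reads off row suc n of the table.
-- Given any sequence s, the new point y stores s n in row suc n (so that
-- s n = F (suc n) y) and diagonalises against s in row 0
-- (y ⟨ 0 , m ⟩ = not (s m ⟨ 0 , m ⟩), so y differs from every s m).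
-- Every reindexing is continuous, and reindexings along different index
-- maps differ, which gives continuity and injectivity of the family.
-- A general extension lemma finishes the proof: if F consists of maps
-- respecting pointwise equality, contains the identity, covers P × P, and
-- every point of P is F i y for some i, then F covers
-- (P ∪ {y}) × (P ∪ {y}).  The construction of y works for every sequence
-- s.

open import Defs
open import Data.Nat using (ℕ; zero; suc; _+_; _<_; _⊔_; _≡ᵇ_)
open import Data.Nat.Properties
  using (+-suc; +-comm; +-identityʳ; m≤m⊔n; m<n⇒m<o⊔n; m<1+n⇒m<n∨m≡n; ≡ᵇ⇒≡; ≡⇒≡ᵇ)
open import Data.Bool using (Bool; not; T)
open import Data.Bool.Properties using (not-¬)
open import Data.Product using (Σ; ∃; _×_; _,_; proj₁)
open import Data.Sum using (_⊎_; inj₁; inj₂)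
open import Relation.Nullary using (¬_)
open import Relation.Binary.PropositionalEquality

≈-sym : ∀ {x z} → x ≈ z → z ≈ x
≈-sym x≈z k = sym (x≈z k)

≈-trans : ∀ {x y z} → x ≈ y → y ≈ z → x ≈ z
≈-trans x≈y y≈z k = trans (x≈y k) (y≈z k)

-- Cantor's pairing.  unpair j walks j steps along the antidiagonals
-- (0,0), (1,0), (0,1), (2,0), (1,1), (0,2), … ; pair is its inverse.
next : ℕ × ℕ → ℕ × ℕ
next (zero  , k) = suc k , 0
next (suc n , k) = n , suc k

unpair : ℕ → ℕ × ℕ
unpair zero    = 0 , 0
unpair (suc j) = next (unpair j)

-- tri d is the position at which the walk enters antidiagonal d.
tri : ℕ → ℕ
tri zero    = 0
tri (suc d) = suc d + tri d

pair : ℕ → ℕ → ℕ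
pair n k = tri (k + n) + k

unpair-walk : ∀ j m n k → unpair j ≡ (m + n , k) → unpair (j + m) ≡ (n , m + k)
unpair-walk j zero n k eq rewrite +-identityʳ j = eq
unpair-walk j (suc m) n k eq
  rewrite +-suc j m | sym (+-suc m k) = unpair-walk (suc j) m n (suc k) (cong next eq)

unpair-tri : ∀ d → unpair (tri d) ≡ (d , 0)
unpair-tri zero = refl
unpair-tri (suc d) = begin
  unpair (suc (d + tri d))  ≡⟨ cong (λ j → unpair (suc j)) (+-comm d (tri d)) ⟩
  next (unpair (tri d + d)) ≡⟨ cong next end-of-diagonal ⟩
  next (0 , d + 0)          ≡⟨ cong (λ k → next (0 , k)) (+-identityʳ d) ⟩
  (suc d , 0)               ∎
  where
  open ≡-Reasoning
  end-of-diagonal : unpair (tri d + d) ≡ (0 , d + 0)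
  end-of-diagonal = unpair-walk (tri d) d 0 0
    (trans (unpair-tri d) (cong (_, 0) (sym (+-identityʳ d))))

unpair-pair : ∀ n k → unpair (pair n k) ≡ (n , k)
unpair-pair n k =
  trans (unpair-walk (tri (k + n)) k n 0 (unpair-tri (k + n)))
        (cong (n ,_) (+-identityʳ k))

pair-injectiveˡ : ∀ {n n′} k → pair n k ≡ pair n′ k → n ≡ n′
pair-injectiveˡ {n} {n′} k eq =
  cong proj₁ (trans (sym (unpair-pair n k)) (trans (cong unpair eq) (unpair-pair n′ k)))

reindex : (ℕ → ℕ) → Cantor → Cantor
reindex p x k = x (p k)

-- bound p n exceeds p k for every k < n; it is a modulus of continuity.
bound : (ℕ → ℕ) → ℕ → ℕ
bound p zero    = 0
bound p (suc n) = suc (p n) ⊔ bound p n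

bound-above : ∀ p n k → k < n → p k < bound p n
bound-above p (suc n) k k<1+n with m<1+n⇒m<n∨m≡n k<1+n
... | inj₁ k<n  = m<n⇒m<o⊔n (suc (p n)) (bound-above p n k k<n)
... | inj₂ refl = m≤m⊔n (suc (p k)) (bound p n)

-- Every reindexing is continuous: the first n output coordinates only
-- depend on the first bound p n input coordinates.
reindex-continuous : ∀ p → Continuous (reindex p)
reindex-continuous p x n =
  bound p n , λ z agree k k<n → agree (p k) (bound-above p n k k<n)

-- Reindexings along different index maps are different maps: testing on
-- the indicator of q k recovers p k ≡ q k.
reindex-injective : ∀ p q → (∀ x → reindex p x ≈ reindex q x) → ∀ k → p k ≡ q k
reindex-injective p q same k = ≡ᵇ⇒≡ (p k) (q k) (subst T (sym (same indicator k)) hit)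
  where
  indicator : Cantor
  indicator j = j ≡ᵇ q k
  hit : T (q k ≡ᵇ q k)
  hit = ≡⇒≡ᵇ (q k) (q k) refl

Extensional : (Cantor → Cantor) → Set
Extensional f = ∀ {x z} → x ≈ z → f x ≈ f z

reindex-extensional : ∀ p → Extensional (reindex p)
reindex-extensional p x≈z k = x≈z (p k)

extend-cover : ∀ (F : ℕ → Cantor → Cantor) (P : Cantor → Set) y →
  (∀ i → Extensional (F i)) →
  (∃ λ i → ∀ x → F i x ≈ x) →
  (∀ a → P a → ∃ λ i → a ≈ F i y) →
  CoveredSq F P → CoveredSq F (λ x → P x ⊎ x ≈ y)
extend-cover F P y ext (id , F-id) images cov = cover
  where
  cover : CoveredSq F (λ x → P x ⊎ x ≈ y)
  cover a b (inj₁ Pa) (inj₁ Pb) = cov a b Pa Pb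
  cover a b (inj₁ Pa) (inj₂ b≈y) with images a Pa
  ... | i , a≈Fiy = i , inj₂ (≈-trans a≈Fiy (ext i (≈-sym b≈y)))
  cover a b (inj₂ a≈y) (inj₁ Pb) with images b Pb
  ... | i , b≈Fiy = i , inj₁ (≈-trans b≈Fiy (ext i (≈-sym a≈y)))
  cover a b (inj₂ a≈y) (inj₂ b≈y) =
    id , inj₁ (≈-trans b≈y (≈-trans (≈-sym a≈y) (≈-sym (F-id a))))

-- The family: F 0 is the identity, F (suc n) reads row suc n of the
-- table y ⟨ r , k ⟩.  Row 0 is reserved for diagonalisation.
coord : ℕ → ℕ → ℕ
coord zero    k = k
coord (suc n) k = pair (suc n) k

family : ℕ → Cantor → Cantor
family i = reindex (coord i)

-- Column 0 of coord i is the pairing, so it determines i.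
coord-origin : ∀ i → coord i 0 ≡ pair i 0
coord-origin zero    = refl
coord-origin (suc n) = refl

family-injective : InjectiveFamily family
family-injective i j same = pair-injectiveˡ 0 (begin
  pair i 0  ≡⟨ sym (coord-origin i) ⟩
  coord i 0 ≡⟨ reindex-injective (coord i) (coord j) same 0 ⟩
  coord j 0 ≡⟨ coord-origin j ⟩
  pair j 0  ∎)
  where open ≡-Reasoning

cell : (ℕ → Cantor) → ℕ → ℕ × ℕ → Bool
cell s j (zero  , m) = not (s m j)
cell s j (suc n , k) = s n k

newPoint : (ℕ → Cantor) → Cantor
newPoint s j = cell s j (unpair j)

newPoint-rows : ∀ s n → s n ≈ family (suc n) (newPoint s)
newPoint-rows s n k = sym (cong (cell s (pair (suc n) k)) (unpair-pair (suc n) k))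

newPoint-fresh : ∀ s → ¬ InS s (newPoint s)
newPoint-fresh s (m , s-m≈y) = not-¬ refl (trans (s-m≈y j) diagonal)
  where
  j : ℕ
  j = pair 0 m
  diagonal : newPoint s j ≡ not (s m j)
  diagonal = cong (cell s j) (unpair-pair 0 m)

theorem2p2 : Σ (ℕ → Cantor → Cantor) λ F →
    InjectiveFamily F × (∀ i → Continuous (F i)) ×
    ((s : ℕ → Cantor) → InjectiveSeq s → CoveredSq F (InS s) →
      Σ Cantor λ y → ¬ InS s y ×
        CoveredSq F (λ x → InS s x ⊎ x ≈ y) ×
        (∀ n → ∃ λ i → s n ≈ F i y))
theorem2p2 =
  family , family-injective , (λ i → reindex-continuous (coord i)) , extend
  where
  extend : (s : ℕ → Cantor) → InjectiveSeq s → CoveredSq family (InS s) →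
    Σ Cantor λ y → ¬ InS s y ×
      CoveredSq family (λ x → InS s x ⊎ x ≈ y) ×
      (∀ n → ∃ λ i → s n ≈ family i y)
  extend s _ cov =
    newPoint s , newPoint-fresh s ,
    extend-cover family (InS s) (newPoint s)
      (λ i → reindex-extensional (coord i)) (0 , λ x k → refl) images cov ,
    (λ n → suc n , newPoint-rows s n)
    where
    images : ∀ a → InS s a → ∃ λ i → a ≈ family i (newPoint s)
    images a (n , s-n≈a) = suc n , ≈-trans (≈-sym s-n≈a) (newPoint-rows s n)
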